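{- Let $X$ be a board and $T$ a subset of $X$. Then $$S(X)=\sum_{U:\,T\subset U\subset \mathrm{Cl}(T)}S(X\setminus U)\,S(T;U).$$
   Context: A board is a finite subset of $\mathbb{Z}\times\mathbb{Z}$. A domino tiling of a board $X$ is a set $D$ of two-element subsets of $X$, each consisting of two adjacent points (distance $1$), such that every point of $X$ lies in exactly one element of $D$; $\mathrm{D}(X)$ denotes the set of domino tilings (the empty board has exactly one tiling). A domino $\{(i,j),(i+1,j)\}$ is horizontal and $h(D)$ is the number of horizontal dominoes. Set $s(D)=\sqrt{ -1}^{\,h(D)}$ and $S(X)=\sum_{D\in\mathrm{D}(X)}s(D)$. For $T\subset X$ and $D\in\mathrm{D}(X)$, $T$ is closed for $D$ if no domino of $D$ meets both $T$ and $X\setminus T$; $\mathrm{Cl}_D(T)$ is the minimal subset of $X$ containing $T$ that is closed for $D$; $\mathrm{Cl}(T)$ is the union of $\mathrm{Cl}_D(T)$ over all $D\in\mathrm{D}(X)$. For a board $U$ containing $T$, $S(T;U)=\sum_{D\in\mathrm{D}(U):\,\mathrm{Cl}_D(T)=U}s(D)$. -}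

module Defs where

open import Data.Bool using (Bool; true; false; _∧_; _∨_; not)
open import Data.Nat using (ℕ; zero; suc)
open import Data.Integer as ℤ using (ℤ; +_)
open import Data.Product using (_×_; _,_)
open import Data.Product.Properties using (≡-dec)
open import Data.List using (List; []; _∷_; _++_; map; foldr; filterᵇ; length; concatMap)
open import Data.Bool.ListAction using (any; all)
open import Relation.Nullary.Decidable using (⌊_⌋)

record ℤ[i] : Set where
  constructor mkG
  field
    re : ℤ
    im : ℤ

0ᴳ 1ᴳ iᴳ : ℤ[i]
0ᴳ = mkG (+ 0) (+ 0)
1ᴳ = mkG (+ 1) (+ 0)
iᴳ = mkG (+ 0) (+ 1)

infixl 6 _+ᴳ_
infixl 7 _*ᴳ_

_+ᴳ_ : ℤ[i] → ℤ[i] → ℤ[i]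
mkG a b +ᴳ mkG c d = mkG (a ℤ.+ c) (b ℤ.+ d)

_*ᴳ_ : ℤ[i] → ℤ[i] → ℤ[i]
mkG a b *ᴳ mkG c d = mkG (a ℤ.* c ℤ.- b ℤ.* d) (a ℤ.* d ℤ.+ b ℤ.* c)

_^ᴳ_ : ℤ[i] → ℕ → ℤ[i]
z ^ᴳ zero    = 1ᴳ
z ^ᴳ (suc n) = z *ᴳ (z ^ᴳ n)

sumᴳ : {A : Set} → (A → ℤ[i]) → List A → ℤ[i]
sumᴳ f = foldr (λ a acc → f a +ᴳ acc) 0ᴳ

-- Points, boards, finite sets as (duplicate-free) lists

Point : Set
Point = ℤ × ℤ

_≟P_ : (p q : Point) → _
_≟P_ = ≡-dec ℤ._≟_ ℤ._≟_

_∈ᵇ_ : Point → List Point → Bool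
x ∈ᵇ xs = any (λ y → ⌊ x ≟P y ⌋) xs

_⊆ᵇ_ : List Point → List Point → Bool
A ⊆ᵇ B = all (_∈ᵇ B) A

_∖_ : List Point → List Point → List Point
X ∖ U = filterᵇ (λ x → not (x ∈ᵇ U)) X

-- all sublists of a list; for a duplicate-free list these are exactly
-- its subsets, each listed once
subsets : {A : Set} → List A → List (List A)
subsets []       = [] ∷ []
subsets (x ∷ xs) = let r = subsets xs in map (x ∷_) r ++ r

-- Dominoes.  A two-element set {a , b} of points at distance 1 is
-- uniquely of the form {p , p + (1,0)} (horizontal) or {p , p + (0,1)}
-- (vertical); we encode it as (p , direction).

data Dir : Set where
  hor ver : Dir

Domino : Set
Domino = Point × Dir

other : Domino → Point
other ((i , j) , hor) = (i ℤ.+ + 1 , j)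
other ((i , j) , ver) = (i , j ℤ.+ + 1)

cells : Domino → List Point
cells (p , d) = p ∷ other (p , d) ∷ []

isHorizontal : Domino → Bool
isHorizontal (_ , hor) = true
isHorizontal (_ , ver) = false

candidates : List Point → List Domino
candidates X =
  concatMap (λ p → filterᵇ (λ d → other d ∈ᵇ X) ((p , hor) ∷ (p , ver) ∷ [])) X

coverCount : List Domino → Point → ℕ
coverCount D x = length (filterᵇ (λ d → x ∈ᵇ cells d) D)

isOne : ℕ → Bool
isOne (suc zero) = true
isOne _          = false

isTiling : List Point → List Domino → Bool
isTiling X D = all (λ x → isOne (coverCount D x)) X

-- D(X): the domino tilings of X, each listed once (X duplicate-free)
tilings : List Point → List (List Domino)
tilings X = filterᵇ (isTiling X) (subsets (candidates X))

h : List Domino → ℕ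
h D = length (filterᵇ isHorizontal D)

s : List Domino → ℤ[i]
s D = iᴳ ^ᴳ h D

S : List Point → ℤ[i]
S X = sumᴳ s (tilings X)

meets : Domino → List Point → Bool
meets d V = any (_∈ᵇ V) (cells d)

isClosed : List Point → List Domino → List Point → Bool
isClosed Y D V = all (λ d → not (meets d V ∧ meets d (Y ∖ V))) D

-- x ∈ Cl_D(T) (within the board Y): the minimal subset of Y containing T
-- that is closed for D, i.e. the intersection of all such subsets
inClD : List Point → List Domino → List Point → Point → Bool
inClD Y D T x =
  (x ∈ᵇ Y) ∧ all (λ V → not ((T ⊆ᵇ V) ∧ isClosed Y D V) ∨ (x ∈ᵇ V)) (subsets Y)

inCl : List Point → List Point → Point → Bool
inCl X T x = any (λ D → inClD X D T x) (tilings X)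

-- Cl_D(T) = U  (inside the board U; Cl_D(T) ⊆ U holds by definition of inClD)
ClDequals : List Point → List Domino → List Point → Bool
ClDequals U D T = all (inClD U D T) U

Srel : List Point → List Point → ℤ[i]
Srel T U = sumᴳ s (filterᵇ (λ D → ClDequals U D T) (tilings U))

between : List Point → List Point → List (List Point)
between X T = filterᵇ (λ U → (T ⊆ᵇ U) ∧ all (inCl X T) U) (subsets X)

{-# OPTIONS --safe #-}
-- Group the tilings D of X by U = Cl_D(T); every such U satisfies T ⊆ U ⊆ Cl(T).  Since U is closed
-- for D, the tiling D is the disjoint union of a tiling D₁ of X ∖ U and a tiling D₂ of U, and
-- s(D) = s(D₁) s(D₂).  The closed subsets of U for D₂ are exactly the closed subsets of X for D that
-- lie in U, so Cl_D(T) = Cl_{D₂}(T).  Conversely any pair (D₁ , D₂) with Cl_{D₂}(T) = U glues to a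
-- tiling D of X with Cl_D(T) = U, so the sum over the tilings with closure U factors as S(X ∖ U) S(T;U).
module Submission where

open import Defs
open import Data.Bool using (Bool; true; false; _∧_; _∨_; not; _xor_)
open import Data.Bool.Properties using (∧-comm; ∧-zeroʳ; ∧-identityʳ)
open import Data.Bool.ListAction using (any; all)
open import Data.Empty using (⊥-elim)
import Data.Integer as ℤ
import Data.Integer.Properties as ℤ
open import Data.Integer.Tactic.RingSolver using (solve-∀)
open import Data.List using (List; []; _∷_; _++_; map; filterᵇ; length; concatMap)
open import Data.List.Properties using (≡-dec; ∷-injectiveʳ; filter-++)
open import Data.List.Membership.Propositional using (_∈_; _∉_)
open import Data.List.Membership.Propositional.Properties using (∈-++⁻; ∈-++⁺ˡ; ∈-++⁺ʳ; ∈-map⁻; ∈-map⁺)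
open import Data.List.Relation.Unary.All as All using (All)
open import Data.List.Relation.Unary.Any using (here; there)
open import Data.List.Relation.Unary.Unique.Propositional using (Unique)
open import Data.List.Relation.Unary.AllPairs using (_∷_)
open import Data.Nat using (zero; suc; _+_)
open import Data.Nat.Properties using (+-suc)
open import Data.Product using (Σ; _×_; _,_; proj₁; proj₂)
open import Data.Sum using (_⊎_; inj₁; inj₂)
open import Function using (_∘_; case_of_)
open import Relation.Binary.PropositionalEquality using (_≡_; _≢_; refl; sym; trans; cong; cong₂; subst; ≢-sym; module ≡-Reasoning)
open import Relation.Nullary using (yes; no)
open import Relation.Nullary.Decidable using (⌊_⌋; T?)

+ᴳ-comm : ∀ x y → x +ᴳ y ≡ y +ᴳ x
+ᴳ-comm (mkG a b) (mkG c d) = cong₂ mkG (ℤ.+-comm a c) (ℤ.+-comm b d)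

+ᴳ-assoc : ∀ x y z → (x +ᴳ y) +ᴳ z ≡ x +ᴳ (y +ᴳ z)
+ᴳ-assoc (mkG a b) (mkG c d) (mkG e f) = cong₂ mkG (ℤ.+-assoc a c e) (ℤ.+-assoc b d f)

+ᴳ-identityˡ : ∀ x → 0ᴳ +ᴳ x ≡ x
+ᴳ-identityˡ (mkG a b) = cong₂ mkG (ℤ.+-identityˡ a) (ℤ.+-identityˡ b)

+ᴳ-identityʳ : ∀ x → x +ᴳ 0ᴳ ≡ x
+ᴳ-identityʳ x = trans (+ᴳ-comm x 0ᴳ) (+ᴳ-identityˡ x)

+ᴳ-interchange : ∀ w x y z → (w +ᴳ x) +ᴳ (y +ᴳ z) ≡ (w +ᴳ y) +ᴳ (x +ᴳ z)
+ᴳ-interchange w x y z = begin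
  (w +ᴳ x) +ᴳ (y +ᴳ z) ≡⟨ +ᴳ-assoc w x (y +ᴳ z) ⟩
  w +ᴳ (x +ᴳ (y +ᴳ z)) ≡⟨ cong (w +ᴳ_) (sym (+ᴳ-assoc x y z)) ⟩
  w +ᴳ ((x +ᴳ y) +ᴳ z) ≡⟨ cong (λ v → w +ᴳ (v +ᴳ z)) (+ᴳ-comm x y) ⟩
  w +ᴳ ((y +ᴳ x) +ᴳ z) ≡⟨ cong (w +ᴳ_) (+ᴳ-assoc y x z) ⟩
  w +ᴳ (y +ᴳ (x +ᴳ z)) ≡⟨ sym (+ᴳ-assoc w y (x +ᴳ z)) ⟩
  (w +ᴳ y) +ᴳ (x +ᴳ z) ∎
  where open ≡-Reasoning

*ᴳ-comm : ∀ x y → x *ᴳ y ≡ y *ᴳ x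
*ᴳ-comm (mkG a b) (mkG c d) =
  cong₂ mkG (cong₂ ℤ._-_ (ℤ.*-comm a c) (ℤ.*-comm b d))
            (trans (cong₂ ℤ._+_ (ℤ.*-comm a d) (ℤ.*-comm b c)) (ℤ.+-comm (d ℤ.* a) (c ℤ.* b)))

*ᴳ-zeroʳ : ∀ x → x *ᴳ 0ᴳ ≡ 0ᴳ
*ᴳ-zeroʳ (mkG a b) rewrite ℤ.*-zeroʳ a | ℤ.*-zeroʳ b = refl

*ᴳ-zeroˡ : ∀ x → 0ᴳ *ᴳ x ≡ 0ᴳ
*ᴳ-zeroˡ x = trans (*ᴳ-comm 0ᴳ x) (*ᴳ-zeroʳ x)

*ᴳ-identityˡ : ∀ x → 1ᴳ *ᴳ x ≡ x
*ᴳ-identityˡ (mkG a b)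
  rewrite ℤ.*-identityˡ a | ℤ.*-identityˡ b | ℤ.+-identityʳ a | ℤ.+-identityʳ b = refl

*ᴳ-assoc : ∀ x y z → (x *ᴳ y) *ᴳ z ≡ x *ᴳ (y *ᴳ z)
*ᴳ-assoc (mkG a b) (mkG c d) (mkG e f) = cong₂ mkG (re a b c d e f) (im a b c d e f)
  where
  re : ∀ a b c d e f →
    (a ℤ.* c ℤ.- b ℤ.* d) ℤ.* e ℤ.- (a ℤ.* d ℤ.+ b ℤ.* c) ℤ.* f ≡
    a ℤ.* (c ℤ.* e ℤ.- d ℤ.* f) ℤ.- b ℤ.* (c ℤ.* f ℤ.+ d ℤ.* e)
  re = solve-∀
  im : ∀ a b c d e f →
    (a ℤ.* c ℤ.- b ℤ.* d) ℤ.* f ℤ.+ (a ℤ.* d ℤ.+ b ℤ.* c) ℤ.* e ≡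
    a ℤ.* (c ℤ.* f ℤ.+ d ℤ.* e) ℤ.+ b ℤ.* (c ℤ.* e ℤ.- d ℤ.* f)
  im = solve-∀

*ᴳ-distribˡ-+ᴳ : ∀ x y z → x *ᴳ (y +ᴳ z) ≡ x *ᴳ y +ᴳ x *ᴳ z
*ᴳ-distribˡ-+ᴳ (mkG a b) (mkG c d) (mkG e f) = cong₂ mkG (re a b c d e f) (im a b c d e f)
  where
  re : ∀ a b c d e f →
    a ℤ.* (c ℤ.+ e) ℤ.- b ℤ.* (d ℤ.+ f) ≡ (a ℤ.* c ℤ.- b ℤ.* d) ℤ.+ (a ℤ.* e ℤ.- b ℤ.* f)
  re = solve-∀
  im : ∀ a b c d e f →
    a ℤ.* (d ℤ.+ f) ℤ.+ b ℤ.* (c ℤ.+ e) ≡ (a ℤ.* d ℤ.+ b ℤ.* c) ℤ.+ (a ℤ.* f ℤ.+ b ℤ.* e)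
  im = solve-∀

*ᴳ-distribʳ-+ᴳ : ∀ x y z → (y +ᴳ z) *ᴳ x ≡ y *ᴳ x +ᴳ z *ᴳ x
*ᴳ-distribʳ-+ᴳ x y z = begin
  (y +ᴳ z) *ᴳ x      ≡⟨ *ᴳ-comm (y +ᴳ z) x ⟩
  x *ᴳ (y +ᴳ z)      ≡⟨ *ᴳ-distribˡ-+ᴳ x y z ⟩
  x *ᴳ y +ᴳ x *ᴳ z   ≡⟨ cong₂ _+ᴳ_ (*ᴳ-comm x y) (*ᴳ-comm x z) ⟩
  y *ᴳ x +ᴳ z *ᴳ x   ∎
  where open ≡-Reasoning

^ᴳ-distribˡ-+-*ᴳ : ∀ z m n → z ^ᴳ (m + n) ≡ z ^ᴳ m *ᴳ z ^ᴳ n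
^ᴳ-distribˡ-+-*ᴳ z zero    n = sym (*ᴳ-identityˡ (z ^ᴳ n))
^ᴳ-distribˡ-+-*ᴳ z (suc m) n =
  trans (cong (z *ᴳ_) (^ᴳ-distribˡ-+-*ᴳ z m n)) (sym (*ᴳ-assoc z (z ^ᴳ m) (z ^ᴳ n)))

infixr 5 [_]ᴳ_

[_]ᴳ_ : Bool → ℤ[i] → ℤ[i]
[ true  ]ᴳ z = z
[ false ]ᴳ z = 0ᴳ

[]ᴳ-∧ : ∀ a b z → [ a ]ᴳ [ b ]ᴳ z ≡ [ a ∧ b ]ᴳ z
[]ᴳ-∧ true  b z = refl
[]ᴳ-∧ false b z = refl

[]ᴳ-*ᴳ : ∀ a b z w → ([ a ]ᴳ z) *ᴳ ([ b ]ᴳ w) ≡ [ a ∧ b ]ᴳ (z *ᴳ w)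
[]ᴳ-*ᴳ true  true  z w = refl
[]ᴳ-*ᴳ true  false z w = *ᴳ-zeroʳ z
[]ᴳ-*ᴳ false b     z w = *ᴳ-zeroˡ ([ b ]ᴳ w)

[]ᴳ-cong : ∀ a {z w} → (a ≡ true → z ≡ w) → [ a ]ᴳ z ≡ [ a ]ᴳ w
[]ᴳ-cong true  z≡w = z≡w refl
[]ᴳ-cong false _   = refl

[]ᴳ-false : ∀ {a} z → a ≢ true → [ a ]ᴳ z ≡ 0ᴳ
[]ᴳ-false {true}  z a≢true = ⊥-elim (a≢true refl)
[]ᴳ-false {false} z _      = refl

module _ {A : Set} where

  sumᴳ-cong : ∀ {f g : A → ℤ[i]} L → (∀ {x} → x ∈ L → f x ≡ g x) → sumᴳ f L ≡ sumᴳ g L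
  sumᴳ-cong []      f≗g = refl
  sumᴳ-cong (x ∷ L) f≗g = cong₂ _+ᴳ_ (f≗g (here refl)) (sumᴳ-cong L (f≗g ∘ there))

  sumᴳ-zero : ∀ (f : A → ℤ[i]) L → (∀ {x} → x ∈ L → f x ≡ 0ᴳ) → sumᴳ f L ≡ 0ᴳ
  sumᴳ-zero f L f≗0 = trans (sumᴳ-cong L f≗0) (sumᴳ-const0 L)
    where
    sumᴳ-const0 : ∀ L → sumᴳ (λ _ → 0ᴳ) L ≡ 0ᴳ
    sumᴳ-const0 []      = refl
    sumᴳ-const0 (_ ∷ L) = trans (+ᴳ-identityˡ _) (sumᴳ-const0 L)

  sumᴳ-filterᵇ : ∀ (f : A → ℤ[i]) p L → sumᴳ f (filterᵇ p L) ≡ sumᴳ (λ x → [ p x ]ᴳ f x) L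
  sumᴳ-filterᵇ f p []      = refl
  sumᴳ-filterᵇ f p (x ∷ L) with p x
  ... | true  = cong (f x +ᴳ_) (sumᴳ-filterᵇ f p L)
  ... | false = trans (sumᴳ-filterᵇ f p L) (sym (+ᴳ-identityˡ _))

  sumᴳ-++ : ∀ (f : A → ℤ[i]) L M → sumᴳ f (L ++ M) ≡ sumᴳ f L +ᴳ sumᴳ f M
  sumᴳ-++ f []      M = sym (+ᴳ-identityˡ (sumᴳ f M))
  sumᴳ-++ f (x ∷ L) M =
    trans (cong (f x +ᴳ_) (sumᴳ-++ f L M)) (sym (+ᴳ-assoc (f x) (sumᴳ f L) (sumᴳ f M)))

  sumᴳ-+ᴳ : ∀ (f g : A → ℤ[i]) L → sumᴳ (λ x → f x +ᴳ g x) L ≡ sumᴳ f L +ᴳ sumᴳ g L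
  sumᴳ-+ᴳ f g []      = sym (+ᴳ-identityˡ 0ᴳ)
  sumᴳ-+ᴳ f g (x ∷ L) = trans (cong (f x +ᴳ g x +ᴳ_) (sumᴳ-+ᴳ f g L))
                              (+ᴳ-interchange (f x) (g x) (sumᴳ f L) (sumᴳ g L))

  *ᴳ-distribˡ-sumᴳ : ∀ z (f : A → ℤ[i]) L → z *ᴳ sumᴳ f L ≡ sumᴳ (λ x → z *ᴳ f x) L
  *ᴳ-distribˡ-sumᴳ z f []      = *ᴳ-zeroʳ z
  *ᴳ-distribˡ-sumᴳ z f (x ∷ L) =
    trans (*ᴳ-distribˡ-+ᴳ z (f x) (sumᴳ f L)) (cong (z *ᴳ f x +ᴳ_) (*ᴳ-distribˡ-sumᴳ z f L))

  *ᴳ-distribʳ-sumᴳ : ∀ z (f : A → ℤ[i]) L → sumᴳ f L *ᴳ z ≡ sumᴳ (λ x → f x *ᴳ z) L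
  *ᴳ-distribʳ-sumᴳ z f []      = *ᴳ-zeroˡ z
  *ᴳ-distribʳ-sumᴳ z f (x ∷ L) =
    trans (*ᴳ-distribʳ-+ᴳ z (f x) (sumᴳ f L)) (cong (f x *ᴳ z +ᴳ_) (*ᴳ-distribʳ-sumᴳ z f L))

sumᴳ-map : ∀ {A B : Set} (f : B → ℤ[i]) (g : A → B) L → sumᴳ f (map g L) ≡ sumᴳ (f ∘ g) L
sumᴳ-map f g []      = refl
sumᴳ-map f g (x ∷ L) = cong (f (g x) +ᴳ_) (sumᴳ-map f g L)

sumᴳ-comm : ∀ {A B : Set} (F : A → B → ℤ[i]) L M →
  sumᴳ (λ x → sumᴳ (F x) M) L ≡ sumᴳ (λ y → sumᴳ (λ x → F x y) L) M
sumᴳ-comm F []      M = sym (sumᴳ-zero _ M (λ _ → refl))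
sumᴳ-comm F (x ∷ L) M = trans (cong (sumᴳ (F x) M +ᴳ_) (sumᴳ-comm F L M))
                              (sym (sumᴳ-+ᴳ (F x) (λ y → sumᴳ (λ x → F x y) L) M))

sumᴳ-*ᴳ-sumᴳ : ∀ {A B : Set} (f : A → ℤ[i]) (g : B → ℤ[i]) L M →
  sumᴳ (λ x → sumᴳ (λ y → f x *ᴳ g y) M) L ≡ sumᴳ f L *ᴳ sumᴳ g M
sumᴳ-*ᴳ-sumᴳ f g L M = begin
  sumᴳ (λ x → sumᴳ (λ y → f x *ᴳ g y) M) L ≡⟨ sumᴳ-cong L (λ {x} _ → sym (*ᴳ-distribˡ-sumᴳ (f x) g M)) ⟩
  sumᴳ (λ x → f x *ᴳ sumᴳ g M) L          ≡⟨ sym (*ᴳ-distribʳ-sumᴳ (sumᴳ g M) f L) ⟩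
  sumᴳ f L *ᴳ sumᴳ g M                    ∎
  where open ≡-Reasoning

∧-true⁻ : ∀ {a b} → a ∧ b ≡ true → a ≡ true × b ≡ true
∧-true⁻ {true} {true} _ = refl , refl

∧-true⁺ : ∀ {a b} → a ≡ true → b ≡ true → a ∧ b ≡ true
∧-true⁺ refl refl = refl

⇔true⇒≡ : ∀ {a b} → (a ≡ true → b ≡ true) → (b ≡ true → a ≡ true) → a ≡ b
⇔true⇒≡ {true}  {b}     a⇒b _   = sym (a⇒b refl)
⇔true⇒≡ {false} {true}  _   b⇒a = b⇒a refl
⇔true⇒≡ {false} {false} _   _   = refl

not-true⁻ : ∀ {a} → not a ≡ true → a ≡ false
not-true⁻ {false} _ = refl

not-xor-true⁻ : ∀ {a b} → not (a xor b) ≡ true → a ≡ b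
not-xor-true⁻ {true}  {true}  _ = refl
not-xor-true⁻ {false} {false} _ = refl

not-xor-true⁺ : ∀ {a b} → a ≡ b → not (a xor b) ≡ true
not-xor-true⁺ {true}  refl = refl
not-xor-true⁺ {false} refl = refl

not-∧-∨-true⁻ : ∀ {a b c} → not (a ∧ b) ∨ c ≡ true → a ≡ true → b ≡ true → c ≡ true
not-∧-∨-true⁻ e refl refl = e

not-∧-∨-true⁺ : ∀ a b {c} → (a ≡ true → b ≡ true → c ≡ true) → not (a ∧ b) ∨ c ≡ true
not-∧-∨-true⁺ true  true  h = h refl refl
not-∧-∨-true⁺ true  false _ = refl
not-∧-∨-true⁺ false b     _ = refl

module _ {A : Set} (p : A → Bool) where

  all-true⁻ : ∀ L → all p L ≡ true → ∀ {x} → x ∈ L → p x ≡ true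
  all-true⁻ (y ∷ L) e (here refl) = proj₁ (∧-true⁻ e)
  all-true⁻ (y ∷ L) e (there x∈L) = all-true⁻ L (proj₂ (∧-true⁻ {p y} e)) x∈L

  all-true⁺ : ∀ L → (∀ {x} → x ∈ L → p x ≡ true) → all p L ≡ true
  all-true⁺ []      _ = refl
  all-true⁺ (y ∷ L) h = ∧-true⁺ (h (here refl)) (all-true⁺ L (h ∘ there))

  all-false⁺ : ∀ L {x} → x ∈ L → p x ≡ false → all p L ≡ false
  all-false⁺ (y ∷ L) (here refl) px rewrite px = refl
  all-false⁺ (y ∷ L) (there x∈L) px with p y
  ... | true  = all-false⁺ L x∈L px
  ... | false = refl

  any-true⁺ : ∀ L {x} → x ∈ L → p x ≡ true → any p L ≡ true
  any-true⁺ (y ∷ L) (here refl) px rewrite px = refl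
  any-true⁺ (y ∷ L) (there x∈L) px with p y
  ... | true  = refl
  ... | false = any-true⁺ L x∈L px

  ∈-filterᵇ⁻ : ∀ L {x} → x ∈ filterᵇ p L → x ∈ L × p x ≡ true
  ∈-filterᵇ⁻ (y ∷ L) x∈ with p y in py
  ∈-filterᵇ⁻ (y ∷ L) (here refl) | true = here refl , py
  ∈-filterᵇ⁻ (y ∷ L) (there x∈)  | true = let x∈L , px = ∈-filterᵇ⁻ L x∈ in there x∈L , px
  ... | false = let x∈L , px = ∈-filterᵇ⁻ L x∈ in there x∈L , px

  ∈-filterᵇ⁺ : ∀ L {x} → x ∈ L → p x ≡ true → x ∈ filterᵇ p L
  ∈-filterᵇ⁺ (y ∷ L) (here refl) px rewrite px = here refl
  ∈-filterᵇ⁺ (y ∷ L) (there x∈L) px with p y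
  ... | true  = there (∈-filterᵇ⁺ L x∈L px)
  ... | false = ∈-filterᵇ⁺ L x∈L px

filterᵇ-cong : ∀ {A : Set} {p q : A → Bool} L → (∀ {x} → x ∈ L → p x ≡ q x) → filterᵇ p L ≡ filterᵇ q L
filterᵇ-cong {p = p} {q} []      _   = refl
filterᵇ-cong {p = p} {q} (y ∷ L) p≗q with p y | q y | p≗q (here refl)
... | true  | true  | _ = cong (y ∷_) (filterᵇ-cong L (p≗q ∘ there))
... | false | false | _ = filterᵇ-cong L (p≗q ∘ there)

filterᵇ-filterᵇ : ∀ {A : Set} (p q : A → Bool) L → filterᵇ q (filterᵇ p L) ≡ filterᵇ (λ x → p x ∧ q x) L
filterᵇ-filterᵇ p q []      = refl
filterᵇ-filterᵇ p q (x ∷ L) with p x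
... | false = filterᵇ-filterᵇ p q L
... | true with q x
...   | true  = cong (x ∷_) (filterᵇ-filterᵇ p q L)
...   | false = filterᵇ-filterᵇ p q L

∈ᵇ⇒∈ : ∀ {x} xs → x ∈ᵇ xs ≡ true → x ∈ xs
∈ᵇ⇒∈ {x} (y ∷ xs) e with x ≟P y
... | yes x≡y = here x≡y
... | no  _   = there (∈ᵇ⇒∈ xs e)

∈⇒∈ᵇ : ∀ {x xs} → x ∈ xs → x ∈ᵇ xs ≡ true
∈⇒∈ᵇ {x} {y ∷ xs} x∈ with x ≟P y | x∈
... | yes _ | _          = refl
... | no  _ | there x∈xs = ∈⇒∈ᵇ x∈xs
... | no x≢y | here x≡y  = ⊥-elim (x≢y x≡y)

∉⇒∈ᵇ-false : ∀ {x} xs → x ∉ xs → x ∈ᵇ xs ≡ false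
∉⇒∈ᵇ-false []       _   = refl
∉⇒∈ᵇ-false {x} (y ∷ xs) x∉ with x ≟P y
... | yes x≡y = ⊥-elim (x∉ (here x≡y))
... | no  _   = ∉⇒∈ᵇ-false xs (x∉ ∘ there)

∈ᵇ-filterᵇ : ∀ (q : Point → Bool) y X → y ∈ᵇ filterᵇ q X ≡ q y ∧ y ∈ᵇ X
∈ᵇ-filterᵇ q y X = ⇔true⇒≡ ⇒ ⇐
  where
  ⇒ : y ∈ᵇ filterᵇ q X ≡ true → q y ∧ y ∈ᵇ X ≡ true
  ⇒ e = let y∈X , qy = ∈-filterᵇ⁻ q X (∈ᵇ⇒∈ _ e) in ∧-true⁺ qy (∈⇒∈ᵇ y∈X)
  ⇐ : q y ∧ y ∈ᵇ X ≡ true → y ∈ᵇ filterᵇ q X ≡ true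
  ⇐ e = let qy , y∈X = ∧-true⁻ e in ∈⇒∈ᵇ (∈-filterᵇ⁺ q X (∈ᵇ⇒∈ X y∈X) qy)

filterᵇ-none : ∀ {A : Set} (p : A → Bool) L → (∀ {x} → x ∈ L → p x ≡ false) → filterᵇ p L ≡ []
filterᵇ-none p []      _  = refl
filterᵇ-none p (x ∷ L) ¬p rewrite ¬p (here refl) = filterᵇ-none p L (¬p ∘ there)

filterᵇ-filterᵇ-redundant : ∀ {A : Set} (p r : A → Bool) L → (∀ {x} → x ∈ L → r x ≡ true → p x ≡ true) →
  filterᵇ r (filterᵇ p L) ≡ filterᵇ r L
filterᵇ-filterᵇ-redundant p r L r⇒p = trans (filterᵇ-filterᵇ p r L) (filterᵇ-cong L pointwise)
  where
  pointwise : ∀ {x} → x ∈ L → p x ∧ r x ≡ r x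
  pointwise {x} x∈L with r x in rx
  ... | true  = trans (∧-identityʳ (p x)) (r⇒p x∈L rx)
  ... | false = ∧-zeroʳ (p x)

module _ {A : Set} where

  ∈-subsets-∷⁻ : ∀ {V} (x : A) xs → V ∈ subsets (x ∷ xs) →
    (Σ (List A) λ V′ → V ≡ x ∷ V′ × V′ ∈ subsets xs) ⊎ V ∈ subsets xs
  ∈-subsets-∷⁻ x xs V∈ with ∈-++⁻ (map (x ∷_) (subsets xs)) V∈
  ... | inj₂ V∈xs = inj₂ V∈xs
  ... | inj₁ V∈map with ∈-map⁻ (x ∷_) V∈map
  ...   | V′ , V′∈ , V≡ = inj₁ (V′ , V≡ , V′∈)

  ∷-∈-subsets : ∀ {V} (x : A) xs → V ∈ subsets xs → x ∷ V ∈ subsets (x ∷ xs)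
  ∷-∈-subsets x xs V∈ = ∈-++⁺ˡ (∈-map⁺ (x ∷_) V∈)

  ∈-subsets-∷ : ∀ {V} (x : A) xs → V ∈ subsets xs → V ∈ subsets (x ∷ xs)
  ∈-subsets-∷ x xs V∈ = ∈-++⁺ʳ (map (x ∷_) (subsets xs)) V∈

  ∈-subsets⇒⊆ : ∀ {V} {y : A} X → V ∈ subsets X → y ∈ V → y ∈ X
  ∈-subsets⇒⊆ []      (here refl) ()
  ∈-subsets⇒⊆ (x ∷ X) V∈ y∈V with ∈-subsets-∷⁻ x X V∈ | y∈V
  ... | inj₁ (V′ , refl , V′∈) | here y≡x   = here y≡x
  ... | inj₁ (V′ , refl , V′∈) | there y∈V′ = there (∈-subsets⇒⊆ X V′∈ y∈V′)
  ... | inj₂ V∈X               | _          = there (∈-subsets⇒⊆ X V∈X y∈V)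

  filterᵇ-∈-subsets : ∀ (p : A → Bool) X → filterᵇ p X ∈ subsets X
  filterᵇ-∈-subsets p []      = here refl
  filterᵇ-∈-subsets p (x ∷ X) with p x
  ... | true  = ∷-∈-subsets x X (filterᵇ-∈-subsets p X)
  ... | false = ∈-subsets-∷ x X (filterᵇ-∈-subsets p X)

  subsets-trans : ∀ {V U : List A} X → V ∈ subsets U → U ∈ subsets X → V ∈ subsets X
  subsets-trans []      V∈ (here refl) = V∈
  subsets-trans (x ∷ X) V∈ U∈ with ∈-subsets-∷⁻ x X U∈
  ... | inj₂ U∈X = ∈-subsets-∷ x X (subsets-trans X V∈ U∈X)
  ... | inj₁ (U′ , refl , U′∈) with ∈-subsets-∷⁻ x U′ V∈
  ...   | inj₁ (V′ , refl , V′∈) = ∷-∈-subsets x X (subsets-trans X V′∈ U′∈)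
  ...   | inj₂ V∈U′              = ∈-subsets-∷ x X (subsets-trans X V∈U′ U′∈)

∈ᵇ-∷-≢ : ∀ {x y} U → y ≢ x → y ∈ᵇ (x ∷ U) ≡ y ∈ᵇ U
∈ᵇ-∷-≢ {x} {y} U y≢x with y ≟P x
... | yes y≡x = ⊥-elim (y≢x y≡x)
... | no  _   = refl

filterᵇ-∈ᵇ-subset : ∀ {U} X → Unique X → U ∈ subsets X → filterᵇ (_∈ᵇ U) X ≡ U
filterᵇ-∈ᵇ-subset []      _            (here refl) = refl
filterᵇ-∈ᵇ-subset (x ∷ X) (x≢ ∷ uX) U∈ with ∈-subsets-∷⁻ x X U∈
... | inj₁ (U′ , refl , U′∈) rewrite ∈⇒∈ᵇ {x} {x ∷ U′} (here refl) =
  cong (x ∷_) (trans (filterᵇ-cong X (λ y∈X → ∈ᵇ-∷-≢ U′ (≢-sym (All.lookup x≢ y∈X))))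
                     (filterᵇ-∈ᵇ-subset X uX U′∈))
... | inj₂ U∈X rewrite ∉⇒∈ᵇ-false {x} _ (λ x∈U → All.lookup x≢ (∈-subsets⇒⊆ X U∈X x∈U) refl) =
  filterᵇ-∈ᵇ-subset X uX U∈X

∈ᵇ-subsets-false : ∀ {V x} U → V ∈ subsets U → x ∈ᵇ U ≡ false → x ∈ᵇ V ≡ false
∈ᵇ-subsets-false {V} {x} U V∈U x∉U with x ∈ᵇ V in x∈V
... | false = refl
... | true  = trans (sym (∈⇒∈ᵇ (∈-subsets⇒⊆ U V∈U (∈ᵇ⇒∈ V x∈V)))) x∉U

sumᴳ-subsets-∷ : ∀ {A : Set} (F : List A → ℤ[i]) x xs →
  sumᴳ F (subsets (x ∷ xs)) ≡ sumᴳ (F ∘ (x ∷_)) (subsets xs) +ᴳ sumᴳ F (subsets xs)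
sumᴳ-subsets-∷ F x xs =
  trans (sumᴳ-++ F (map (x ∷_) (subsets xs)) (subsets xs))
        (cong (_+ᴳ sumᴳ F (subsets xs)) (sumᴳ-map F (x ∷_) (subsets xs)))

infix 4 _≡ᵇ_

_≡ᵇ_ : List Point → List Point → Bool
U ≡ᵇ W = ⌊ ≡-dec _≟P_ U W ⌋

≡ᵇ-true⁻ : ∀ {U W} → (U ≡ᵇ W) ≡ true → U ≡ W
≡ᵇ-true⁻ {U} {W} e with ≡-dec _≟P_ U W
... | yes U≡W = U≡W

≡⇒≡ᵇ : ∀ {U W} → U ≡ W → (U ≡ᵇ W) ≡ true
≡⇒≡ᵇ {U} refl with ≡-dec _≟P_ U U
... | yes _   = refl
... | no U≢U = ⊥-elim (U≢U refl)

≡ᵇ-false⁺ : ∀ {U W} → U ≢ W → (U ≡ᵇ W) ≡ false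
≡ᵇ-false⁺ {U} {W} U≢W with ≡-dec _≟P_ U W
... | yes U≡W = ⊥-elim (U≢W U≡W)
... | no  _   = refl

∷-≡ᵇ-∷ : ∀ x U W → (x ∷ U ≡ᵇ x ∷ W) ≡ (U ≡ᵇ W)
∷-≡ᵇ-∷ x U W = ⇔true⇒≡ (λ e → ≡⇒≡ᵇ (∷-injectiveʳ (≡ᵇ-true⁻ e)))
                         (λ e → ≡⇒≡ᵇ (cong (x ∷_) (≡ᵇ-true⁻ e)))

sumᴳ-subsets-≡ᵇ : ∀ X → Unique X → ∀ {W} → W ∈ subsets X → (z : ℤ[i]) →
  sumᴳ (λ U → [ U ≡ᵇ W ]ᴳ z) (subsets X) ≡ z
sumᴳ-subsets-≡ᵇ []      _         (here refl) z = +ᴳ-identityʳ z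
sumᴳ-subsets-≡ᵇ (x ∷ X) (x≢ ∷ uX) {W} W∈ z with ∈-subsets-∷⁻ x X W∈
... | inj₁ (W′ , refl , W′∈) = begin
  sumᴳ F (subsets (x ∷ X))                                 ≡⟨ sumᴳ-subsets-∷ F x X ⟩
  sumᴳ (F ∘ (x ∷_)) (subsets X) +ᴳ sumᴳ F (subsets X)     ≡⟨ cong₂ _+ᴳ_ with-x without-x ⟩
  z +ᴳ 0ᴳ                                                  ≡⟨ +ᴳ-identityʳ z ⟩
  z                                                        ∎
  where
  open ≡-Reasoning
  F : List Point → ℤ[i]
  F U = [ U ≡ᵇ x ∷ W′ ]ᴳ z
  with-x : sumᴳ (F ∘ (x ∷_)) (subsets X) ≡ z
  with-x = trans (sumᴳ-cong (subsets X) (λ {U} _ → cong ([_]ᴳ z) (∷-≡ᵇ-∷ x U W′)))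
                 (sumᴳ-subsets-≡ᵇ X uX W′∈ z)
  without-x : sumᴳ F (subsets X) ≡ 0ᴳ
  without-x = sumᴳ-zero F (subsets X) λ U∈ → cong ([_]ᴳ z) (≡ᵇ-false⁺ λ { refl →
    All.lookup x≢ (∈-subsets⇒⊆ X U∈ (here refl)) refl })
... | inj₂ W∈X = begin
  sumᴳ F (subsets (x ∷ X))                                 ≡⟨ sumᴳ-subsets-∷ F x X ⟩
  sumᴳ (F ∘ (x ∷_)) (subsets X) +ᴳ sumᴳ F (subsets X)     ≡⟨ cong₂ _+ᴳ_ with-x (sumᴳ-subsets-≡ᵇ X uX W∈X z) ⟩
  0ᴳ +ᴳ z                                                  ≡⟨ +ᴳ-identityˡ z ⟩
  z                                                        ∎
  where
  open ≡-Reasoning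
  F : List Point → ℤ[i]
  F U = [ U ≡ᵇ W ]ᴳ z
  with-x : sumᴳ (F ∘ (x ∷_)) (subsets X) ≡ 0ᴳ
  with-x = sumᴳ-zero (F ∘ (x ∷_)) (subsets X) λ _ → cong ([_]ᴳ z) (≡ᵇ-false⁺ λ { refl →
    All.lookup x≢ (∈-subsets⇒⊆ X W∈X (here refl)) refl })

-- A set D ⊆ C contained in p ∪ q is the same thing as the pair (D ∩ p , D ∩ q).
module _ {A : Set} (p q : A → Bool) (p∧q≡false : ∀ c → p c ∧ q c ≡ false) where

  partitionTerm : (List A → List A → ℤ[i]) → List A → ℤ[i]
  partitionTerm G D = [ all (λ d → p d ∨ q d) D ]ᴳ G (filterᵇ p D) (filterᵇ q D)

  sumᴳ-subsets-partition : ∀ (G : List A → List A → ℤ[i]) C →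
    sumᴳ (λ D₁ → sumᴳ (G D₁) (subsets (filterᵇ q C))) (subsets (filterᵇ p C)) ≡
    sumᴳ (partitionTerm G) (subsets C)
  sumᴳ-subsets-partition G [] = cong (_+ᴳ 0ᴳ) (+ᴳ-identityʳ (G [] []))
  sumᴳ-subsets-partition G (c ∷ C) with p c in pc | q c in qc | p∧q≡false c
  ... | true | false | _ = begin
    sumᴳ (λ D₁ → sumᴳ (G D₁) Q) (subsets (c ∷ filterᵇ p C))
      ≡⟨ sumᴳ-subsets-∷ (λ D₁ → sumᴳ (G D₁) Q) c (filterᵇ p C) ⟩
    sumᴳ (λ D₁ → sumᴳ (G (c ∷ D₁)) Q) P +ᴳ sumᴳ (λ D₁ → sumᴳ (G D₁) Q) P
      ≡⟨ cong₂ _+ᴳ_ (trans (sumᴳ-subsets-partition (G ∘ (c ∷_)) C) (sumᴳ-cong (subsets C) with-c))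
                    (sumᴳ-subsets-partition G C) ⟩
    sumᴳ (partitionTerm G ∘ (c ∷_)) (subsets C) +ᴳ sumᴳ (partitionTerm G) (subsets C)
      ≡⟨ sym (sumᴳ-subsets-∷ (partitionTerm G) c C) ⟩
    sumᴳ (partitionTerm G) (subsets (c ∷ C)) ∎
    where
    open ≡-Reasoning
    P = subsets (filterᵇ p C)
    Q = subsets (filterᵇ q C)
    with-c : ∀ {D} → D ∈ subsets C → partitionTerm (G ∘ (c ∷_)) D ≡ partitionTerm G (c ∷ D)
    with-c _ rewrite pc | qc = refl
  ... | false | true | _ = begin
    sumᴳ (λ D₁ → sumᴳ (G D₁) (subsets (c ∷ filterᵇ q C))) P
      ≡⟨ sumᴳ-cong P (λ {D₁} _ → sumᴳ-subsets-∷ (G D₁) c (filterᵇ q C)) ⟩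
    sumᴳ (λ D₁ → sumᴳ (G′ D₁) Q +ᴳ sumᴳ (G D₁) Q) P
      ≡⟨ sumᴳ-+ᴳ (λ D₁ → sumᴳ (G′ D₁) Q) (λ D₁ → sumᴳ (G D₁) Q) P ⟩
    sumᴳ (λ D₁ → sumᴳ (G′ D₁) Q) P +ᴳ sumᴳ (λ D₁ → sumᴳ (G D₁) Q) P
      ≡⟨ cong₂ _+ᴳ_ (trans (sumᴳ-subsets-partition G′ C) (sumᴳ-cong (subsets C) with-c))
                    (sumᴳ-subsets-partition G C) ⟩
    sumᴳ (partitionTerm G ∘ (c ∷_)) (subsets C) +ᴳ sumᴳ (partitionTerm G) (subsets C)
      ≡⟨ sym (sumᴳ-subsets-∷ (partitionTerm G) c C) ⟩
    sumᴳ (partitionTerm G) (subsets (c ∷ C)) ∎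
    where
    open ≡-Reasoning
    P = subsets (filterᵇ p C)
    Q = subsets (filterᵇ q C)
    G′ : List A → List A → ℤ[i]
    G′ D₁ D₂ = G D₁ (c ∷ D₂)
    with-c : ∀ {D} → D ∈ subsets C → partitionTerm G′ D ≡ partitionTerm G (c ∷ D)
    with-c _ rewrite pc | qc = refl
  ... | false | false | _ = begin
    sumᴳ (λ D₁ → sumᴳ (G D₁) (subsets (filterᵇ q C))) (subsets (filterᵇ p C))
      ≡⟨ sumᴳ-subsets-partition G C ⟩
    sumᴳ (partitionTerm G) (subsets C)
      ≡⟨ sym (+ᴳ-identityˡ _) ⟩
    0ᴳ +ᴳ sumᴳ (partitionTerm G) (subsets C)
      ≡⟨ cong (_+ᴳ _) (sym (sumᴳ-zero (partitionTerm G ∘ (c ∷_)) (subsets C) (λ _ → without-c))) ⟩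
    sumᴳ (partitionTerm G ∘ (c ∷_)) (subsets C) +ᴳ sumᴳ (partitionTerm G) (subsets C)
      ≡⟨ sym (sumᴳ-subsets-∷ (partitionTerm G) c C) ⟩
    sumᴳ (partitionTerm G) (subsets (c ∷ C)) ∎
    where
    open ≡-Reasoning
    without-c : ∀ {D} → partitionTerm G (c ∷ D) ≡ 0ᴳ
    without-c rewrite pc | qc = refl

  length-filterᵇ-partition : ∀ (r : A → Bool) D → all (λ d → p d ∨ q d) D ≡ true →
    length (filterᵇ r D) ≡ length (filterᵇ r (filterᵇ p D)) + length (filterᵇ r (filterᵇ q D))
  length-filterᵇ-partition r []      _  = refl
  length-filterᵇ-partition r (d ∷ D) ok with p d | q d | p∧q≡false d
  ... | true  | false | _ with r d
  ...   | true  = cong suc (length-filterᵇ-partition r D ok)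
  ...   | false = length-filterᵇ-partition r D ok
  length-filterᵇ-partition r (d ∷ D) ok | false | true | _ with r d
  ...   | true  = trans (cong suc (length-filterᵇ-partition r D ok)) (sym (+-suc _ _))
  ...   | false = length-filterᵇ-partition r D ok

inside : (Point → Bool) → Domino → Bool
inside q d = q (proj₁ d) ∧ q (other d)

-- candidates X unfolds to concatMap (dominoesAt X) X.
dominoesAt : List Point → Point → List Domino
dominoesAt Y z = filterᵇ (λ d → other d ∈ᵇ Y) ((z , hor) ∷ (z , ver) ∷ [])

dominoesAt-filterᵇ : ∀ q Y z → q z ≡ true →
  dominoesAt (filterᵇ q Y) z ≡ filterᵇ (inside q) (dominoesAt Y z)
dominoesAt-filterᵇ q Y z qz =
  trans (filterᵇ-cong {p = λ d → other d ∈ᵇ filterᵇ q Y} {q = λ d → other d ∈ᵇ Y ∧ inside q d}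
                      ((z , hor) ∷ (z , ver) ∷ [])
          λ { (here refl) → pointwise hor ; (there (here refl)) → pointwise ver })
        (sym (filterᵇ-filterᵇ (λ d → other d ∈ᵇ Y) (inside q) ((z , hor) ∷ (z , ver) ∷ [])))
  where
  pointwise : ∀ dir → other (z , dir) ∈ᵇ filterᵇ q Y ≡ (other (z , dir) ∈ᵇ Y ∧ inside q (z , dir))
  pointwise dir rewrite ∈ᵇ-filterᵇ q (other (z , dir)) Y | qz = ∧-comm (q (other (z , dir))) _

filterᵇ-inside-dominoesAt : ∀ q Y z → q z ≡ false → filterᵇ (inside q) (dominoesAt Y z) ≡ []
filterᵇ-inside-dominoesAt q Y z qz = filterᵇ-none (inside q) (dominoesAt Y z) λ d∈ →
  outside (proj₁ (∈-filterᵇ⁻ (λ d → other d ∈ᵇ Y) ((z , hor) ∷ (z , ver) ∷ []) d∈))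
  where
  outside : ∀ {d} → d ∈ (z , hor) ∷ (z , ver) ∷ [] → inside q d ≡ false
  outside (here refl)         rewrite qz = refl
  outside (there (here refl)) rewrite qz = refl

candidates-filterᵇ : ∀ q X → candidates (filterᵇ q X) ≡ filterᵇ (inside q) (candidates X)
candidates-filterᵇ q X = go X
  where
  go : ∀ Z → concatMap (dominoesAt (filterᵇ q X)) (filterᵇ q Z) ≡
             filterᵇ (inside q) (concatMap (dominoesAt X) Z)
  go []      = refl
  go (z ∷ Z) with q z in qz
  ... | true  = trans (cong₂ _++_ (dominoesAt-filterᵇ q X z qz) (go Z))
                      (sym (filter-++ (T? ∘ inside q) (dominoesAt X z) (concatMap (dominoesAt X) Z)))
  ... | false = trans (go Z)
                  (sym (trans (filter-++ (T? ∘ inside q) (dominoesAt X z) (concatMap (dominoesAt X) Z))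
                              (cong (_++ _) (filterᵇ-inside-dominoesAt q X z qz))))

CellsIn : List Point → List Domino → Set
CellsIn Y D = ∀ {d} → d ∈ D → proj₁ d ∈ᵇ Y ≡ true × other d ∈ᵇ Y ≡ true

candidates-CellsIn : ∀ X → CellsIn X (candidates X)
candidates-CellsIn X d∈ = let d₁∈X , od∈X = go X d∈ in ∈⇒∈ᵇ d₁∈X , od∈X
  where
  go : ∀ Z {d} → d ∈ concatMap (dominoesAt X) Z → proj₁ d ∈ Z × other d ∈ᵇ X ≡ true
  go (z ∷ Z) d∈ with ∈-++⁻ (dominoesAt X z) d∈
  ... | inj₂ d∈Z = let d₁∈Z , od∈X = go Z d∈Z in there d₁∈Z , od∈X
  ... | inj₁ d∈z with ∈-filterᵇ⁻ (λ d → other d ∈ᵇ X) ((z , hor) ∷ (z , ver) ∷ []) d∈z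
  ...   | here refl         , od∈X = here refl , od∈X
  ...   | there (here refl) , od∈X = here refl , od∈X

CellsIn-subsets : ∀ {Y C D} → CellsIn Y C → D ∈ subsets C → CellsIn Y D
CellsIn-subsets {C = C} cellsC D∈ d∈D = cellsC (∈-subsets⇒⊆ C D∈ d∈D)

cell-cases : ∀ {x} d → x ∈ᵇ cells d ≡ true → x ≡ proj₁ d ⊎ x ≡ other d
cell-cases d x∈d with ∈ᵇ⇒∈ (cells d) x∈d
... | here  x≡d₁        = inj₁ x≡d₁
... | there (here x≡od) = inj₂ x≡od

inside-cell : ∀ (q : Point → Bool) {d x} → q (proj₁ d) ≡ q (other d) →
  x ∈ᵇ cells d ≡ true → q x ≡ true → inside q d ≡ true
inside-cell q {d} {x} agree x∈d qx with cell-cases {x} d x∈d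
... | inj₁ refl = ∧-true⁺ qx (trans (sym agree) qx)
... | inj₂ refl = ∧-true⁺ (trans agree qx) qx

closed-at≡cells-agree : ∀ Y V d → proj₁ d ∈ᵇ Y ≡ true → other d ∈ᵇ Y ≡ true →
  not (meets d V ∧ meets d (Y ∖ V)) ≡ not (proj₁ d ∈ᵇ V xor other d ∈ᵇ V)
closed-at≡cells-agree Y V d d₁∈Y od∈Y
  rewrite ∈ᵇ-filterᵇ (λ x → not (x ∈ᵇ V)) (proj₁ d) Y | ∈ᵇ-filterᵇ (λ x → not (x ∈ᵇ V)) (other d) Y
        | d₁∈Y | od∈Y
  with proj₁ d ∈ᵇ V | other d ∈ᵇ V
... | true  | true  = refl
... | true  | false = refl
... | false | true  = refl
... | false | false = refl

module _ (Y : List Point) {D} (cells⊆Y : CellsIn Y D) where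

  isClosed⁻ : ∀ V → isClosed Y D V ≡ true → ∀ {d} → d ∈ D → proj₁ d ∈ᵇ V ≡ other d ∈ᵇ V
  isClosed⁻ V closed {d} d∈D = let d₁∈Y , od∈Y = cells⊆Y d∈D in
    not-xor-true⁻ (trans (sym (closed-at≡cells-agree Y V d d₁∈Y od∈Y))
                         (all-true⁻ (λ d → not (meets d V ∧ meets d (Y ∖ V))) D closed d∈D))

  isClosed⁺ : ∀ V → (∀ {d} → d ∈ D → proj₁ d ∈ᵇ V ≡ other d ∈ᵇ V) → isClosed Y D V ≡ true
  isClosed⁺ V agree = all-true⁺ (λ d → not (meets d V ∧ meets d (Y ∖ V))) D λ {d} d∈D →
    let d₁∈Y , od∈Y = cells⊆Y d∈D in
    trans (closed-at≡cells-agree Y V d d₁∈Y od∈Y) (not-xor-true⁺ (agree d∈D))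

-- Closures

module Closure (Y : List Point) (D : List Domino) (T : List Point) where

  ClosedSuperset : List Point → Set
  ClosedSuperset V = V ∈ subsets Y × (T ⊆ᵇ V) ≡ true × isClosed Y D V ≡ true

  inClD⇒∈ : ∀ {x V} → inClD Y D T x ≡ true → ClosedSuperset V → x ∈ᵇ V ≡ true
  inClD⇒∈ {x} x∈Cl (V∈ , T⊆V , closed) =
    not-∧-∨-true⁻ (all-true⁻ (λ V → not ((T ⊆ᵇ V) ∧ isClosed Y D V) ∨ (x ∈ᵇ V)) (subsets Y)
                             (proj₂ (∧-true⁻ x∈Cl)) V∈)
                  T⊆V closed

  inClD⁺ : ∀ {x} → x ∈ᵇ Y ≡ true → (∀ {V} → ClosedSuperset V → x ∈ᵇ V ≡ true) → inClD Y D T x ≡ true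
  inClD⁺ {x} x∈Y ∈closed = ∧-true⁺ x∈Y
    (all-true⁺ (λ V → not ((T ⊆ᵇ V) ∧ isClosed Y D V) ∨ (x ∈ᵇ V)) (subsets Y) λ {V} V∈ →
      not-∧-∨-true⁺ (T ⊆ᵇ V) (isClosed Y D V) λ T⊆V closed → ∈closed (V∈ , T⊆V , closed))

  inClD-false⁺ : ∀ {x V} → ClosedSuperset V → x ∈ᵇ V ≡ false → inClD Y D T x ≡ false
  inClD-false⁺ {x} {V} (V∈ , T⊆V , closed) x∉V =
    trans (cong ((x ∈ᵇ Y) ∧_)
                (all-false⁺ (λ V → not ((T ⊆ᵇ V) ∧ isClosed Y D V) ∨ (x ∈ᵇ V)) (subsets Y) V∈ excluded))
          (∧-zeroʳ (x ∈ᵇ Y))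
    where
    excluded : not ((T ⊆ᵇ V) ∧ isClosed Y D V) ∨ (x ∈ᵇ V) ≡ false
    excluded rewrite T⊆V | closed | x∉V = refl

  T⊆inClD : All (_∈ Y) T → ∀ {t} → t ∈ T → inClD Y D T t ≡ true
  T⊆inClD T⊆Y t∈T = inClD⁺ (∈⇒∈ᵇ (All.lookup T⊆Y t∈T))
    λ {V} (_ , T⊆V , _) → all-true⁻ (_∈ᵇ V) T T⊆V t∈T

  inClD-transport : ∀ {x y} → y ∈ᵇ Y ≡ true → (∀ {V} → ClosedSuperset V → x ∈ᵇ V ≡ y ∈ᵇ V) →
    inClD Y D T x ≡ true → inClD Y D T y ≡ true
  inClD-transport y∈Y x≡y x∈Cl = inClD⁺ y∈Y λ cs → trans (sym (x≡y cs)) (inClD⇒∈ x∈Cl cs)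

  -- A closed superset of T contains both cells of a domino of D or neither, so membership in the
  -- closure is transported along the dominoes of D.
  inClD-closed : CellsIn Y D → isClosed Y D (filterᵇ (inClD Y D T) Y) ≡ true
  inClD-closed cells⊆Y = isClosed⁺ Y cells⊆Y (filterᵇ (inClD Y D T) Y) λ {d} d∈D →
    let d₁∈Y , od∈Y = cells⊆Y d∈D
        agree : ∀ {V} → ClosedSuperset V → proj₁ d ∈ᵇ V ≡ other d ∈ᵇ V
        agree {V} (_ , _ , closed) = isClosed⁻ Y cells⊆Y V closed d∈D
    in begin
      proj₁ d ∈ᵇ filterᵇ (inClD Y D T) Y   ≡⟨ ∈ᵇ-filterᵇ (inClD Y D T) (proj₁ d) Y ⟩
      inClD Y D T (proj₁ d) ∧ proj₁ d ∈ᵇ Y ≡⟨ cong₂ _∧_ (⇔true⇒≡ (inClD-transport od∈Y agree)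
                                                                (inClD-transport d₁∈Y (sym ∘ agree)))
                                                       (trans d₁∈Y (sym od∈Y)) ⟩
      inClD Y D T (other d) ∧ other d ∈ᵇ Y ≡⟨ sym (∈ᵇ-filterᵇ (inClD Y D T) (other d) Y) ⟩
      other d ∈ᵇ filterᵇ (inClD Y D T) Y   ∎
    where open ≡-Reasoning

-- Cutting a board along a closed set

module BoardSplit (X U : List Point) (U∈ : U ∈ subsets X) where

  outer inner : Domino → Bool
  outer = inside (λ x → not (x ∈ᵇ U))
  inner = inside (_∈ᵇ U)

  outer∧inner≡false : ∀ d → outer d ∧ inner d ≡ false
  outer∧inner≡false d with proj₁ d ∈ᵇ U | other d ∈ᵇ U
  ... | true  | _     = refl
  ... | false | true  = refl
  ... | false | false = refl

  outer∨inner : ∀ d → outer d ∨ inner d ≡ not (proj₁ d ∈ᵇ U xor other d ∈ᵇ U)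
  outer∨inner d with proj₁ d ∈ᵇ U | other d ∈ᵇ U
  ... | true  | true  = refl
  ... | true  | false = refl
  ... | false | true  = refl
  ... | false | false = refl

  respects : List Domino → Bool
  respects D = all (λ d → outer d ∨ inner d) D

  respects⇒agree : ∀ {D} → respects D ≡ true → ∀ {d} → d ∈ D → proj₁ d ∈ᵇ U ≡ other d ∈ᵇ U
  respects⇒agree {D} resp {d} d∈D =
    not-xor-true⁻ (trans (sym (outer∨inner d)) (all-true⁻ (λ d → outer d ∨ inner d) D resp d∈D))

  respects≡U-closed : ∀ {D} → CellsIn X D → respects D ≡ isClosed X D U
  respects≡U-closed {D} cells⊆X = ⇔true⇒≡
    (λ resp → isClosed⁺ X cells⊆X U (respects⇒agree resp))
    (λ closed → all-true⁺ (λ d → outer d ∨ inner d) D λ {d} d∈D →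
      trans (outer∨inner d) (not-xor-true⁺ (isClosed⁻ X cells⊆X U closed d∈D)))

  inner-CellsIn : ∀ D → CellsIn U (filterᵇ inner D)
  inner-CellsIn D d∈ = ∧-true⁻ (proj₂ (∈-filterᵇ⁻ inner D d∈))

  closed-restrict : ∀ {D V} → CellsIn X D → isClosed X D V ≡ true →
    isClosed U (filterᵇ inner D) (filterᵇ (_∈ᵇ V) U) ≡ true
  closed-restrict {D} {V} cells⊆X closed = isClosed⁺ U (inner-CellsIn D) (filterᵇ (_∈ᵇ V) U) λ {d} d∈D₂ →
    let d∈D , _ = ∈-filterᵇ⁻ inner D d∈D₂
        d₁∈U , od∈U = inner-CellsIn D d∈D₂
    in begin
      proj₁ d ∈ᵇ filterᵇ (_∈ᵇ V) U   ≡⟨ ∈ᵇ-filterᵇ (_∈ᵇ V) (proj₁ d) U ⟩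
      proj₁ d ∈ᵇ V ∧ proj₁ d ∈ᵇ U    ≡⟨ cong₂ _∧_ (isClosed⁻ X cells⊆X V closed d∈D) (trans d₁∈U (sym od∈U)) ⟩
      other d ∈ᵇ V ∧ other d ∈ᵇ U    ≡⟨ sym (∈ᵇ-filterᵇ (_∈ᵇ V) (other d) U) ⟩
      other d ∈ᵇ filterᵇ (_∈ᵇ V) U   ∎
    where open ≡-Reasoning

  module _ {D} (resp : respects D ≡ true) where

    coverCount-inner : ∀ {x} → x ∈ᵇ U ≡ true → coverCount (filterᵇ inner D) x ≡ coverCount D x
    coverCount-inner {x} x∈U = cong length (filterᵇ-filterᵇ-redundant inner (λ d → x ∈ᵇ cells d) D
      λ d∈D x∈d → inside-cell (_∈ᵇ U) (respects⇒agree resp d∈D) x∈d x∈U)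

    coverCount-outer : ∀ {x} → x ∈ᵇ U ≡ false → coverCount (filterᵇ outer D) x ≡ coverCount D x
    coverCount-outer {x} x∉U = cong length (filterᵇ-filterᵇ-redundant outer (λ d → x ∈ᵇ cells d) D
      λ d∈D x∈d → inside-cell (λ x → not (x ∈ᵇ U)) (cong not (respects⇒agree resp d∈D)) x∈d (cong not x∉U))

    s-split : s D ≡ s (filterᵇ outer D) *ᴳ s (filterᵇ inner D)
    s-split = trans (cong (iᴳ ^ᴳ_) (length-filterᵇ-partition outer inner outer∧inner≡false isHorizontal D resp))
                    (^ᴳ-distribˡ-+-*ᴳ iᴳ (h (filterᵇ outer D)) (h (filterᵇ inner D)))

    isTiling-split : isTiling X D ≡ isTiling (X ∖ U) (filterᵇ outer D) ∧ isTiling U (filterᵇ inner D)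
    isTiling-split = ⇔true⇒≡ ⇒ ⇐
      where
      ⇒ : isTiling X D ≡ true → isTiling (X ∖ U) (filterᵇ outer D) ∧ isTiling U (filterᵇ inner D) ≡ true
      ⇒ tiles = ∧-true⁺
        (all-true⁺ _ (X ∖ U) λ y∈ → let y∈X , y∉U = ∈-filterᵇ⁻ (λ x → not (x ∈ᵇ U)) X y∈ in
          trans (cong isOne (coverCount-outer (not-true⁻ y∉U))) (all-true⁻ _ X tiles y∈X))
        (all-true⁺ _ U λ u∈U →
          trans (cong isOne (coverCount-inner (∈⇒∈ᵇ u∈U))) (all-true⁻ _ X tiles (∈-subsets⇒⊆ X U∈ u∈U)))
      ⇐ : isTiling (X ∖ U) (filterᵇ outer D) ∧ isTiling U (filterᵇ inner D) ≡ true → isTiling X D ≡ true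
      ⇐ both = all-true⁺ _ X λ {x} x∈X → by-side x∈X (x ∈ᵇ U) refl
        where
        by-side : ∀ {x} → x ∈ X → ∀ b → x ∈ᵇ U ≡ b → isOne (coverCount D x) ≡ true
        by-side x∈X true x∈U =
          trans (cong isOne (sym (coverCount-inner x∈U))) (all-true⁻ _ U (proj₂ (∧-true⁻ both)) (∈ᵇ⇒∈ U x∈U))
        by-side x∈X false x∉U =
          trans (cong isOne (sym (coverCount-outer x∉U)))
                (all-true⁻ _ (X ∖ U) (proj₁ (∧-true⁻ both)) (∈-filterᵇ⁺ _ X x∈X (cong not x∉U)))

  module _ (T : List Point) {D} (cells⊆X : CellsIn X D) (resp : respects D ≡ true) (T⊆U : (T ⊆ᵇ U) ≡ true) where

    closed-lift : ∀ {V} → V ∈ subsets U → isClosed U (filterᵇ inner D) V ≡ true → isClosed X D V ≡ true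
    closed-lift {V} V∈U closed = isClosed⁺ X cells⊆X V λ {d} d∈D → by-side d∈D (proj₁ d ∈ᵇ U) refl
      where
      by-side : ∀ {d} → d ∈ D → ∀ b → proj₁ d ∈ᵇ U ≡ b → proj₁ d ∈ᵇ V ≡ other d ∈ᵇ V
      by-side d∈D true d₁∈U = isClosed⁻ U (inner-CellsIn D) V closed
        (∈-filterᵇ⁺ inner D d∈D (∧-true⁺ d₁∈U (trans (sym (respects⇒agree resp d∈D)) d₁∈U)))
      by-side d∈D false d₁∉U = trans (∈ᵇ-subsets-false U V∈U d₁∉U)
        (sym (∈ᵇ-subsets-false U V∈U (trans (sym (respects⇒agree resp d∈D)) d₁∉U)))

    inClD-outside : ∀ {x} → x ∈ᵇ U ≡ false → inClD X D T x ≡ false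
    inClD-outside = Closure.inClD-false⁺ X D T (U∈ , T⊆U , trans (sym (respects≡U-closed cells⊆X)) resp)

    inClD-restrict : ∀ {x} → x ∈ᵇ U ≡ true → inClD X D T x ≡ inClD U (filterᵇ inner D) T x
    inClD-restrict {x} x∈U = ⇔true⇒≡ ⇒ ⇐
      where
      ⇒ : inClD X D T x ≡ true → inClD U (filterᵇ inner D) T x ≡ true
      ⇒ x∈Cl = Closure.inClD⁺ U (filterᵇ inner D) T x∈U λ {V} (V∈U , T⊆V , closed) →
        Closure.inClD⇒∈ X D T {V = V} x∈Cl (subsets-trans X V∈U U∈ , T⊆V , closed-lift V∈U closed)
      T⊆V∩U : ∀ {V} → (T ⊆ᵇ V) ≡ true → (T ⊆ᵇ filterᵇ (_∈ᵇ V) U) ≡ true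
      T⊆V∩U {V} T⊆V = all-true⁺ _ T λ t∈T →
        trans (∈ᵇ-filterᵇ (_∈ᵇ V) _ U) (∧-true⁺ (all-true⁻ _ T T⊆V t∈T) (all-true⁻ _ T T⊆U t∈T))
      ⇐ : inClD U (filterᵇ inner D) T x ≡ true → inClD X D T x ≡ true
      ⇐ x∈Cl₂ = Closure.inClD⁺ X D T (∈⇒∈ᵇ (∈-subsets⇒⊆ X U∈ (∈ᵇ⇒∈ U x∈U))) λ {V} (_ , T⊆V , closed) →
        proj₁ (∧-true⁻ (trans (sym (∈ᵇ-filterᵇ (_∈ᵇ V) x U))
          (Closure.inClD⇒∈ U (filterᵇ inner D) T x∈Cl₂
            (filterᵇ-∈-subsets (_∈ᵇ V) U , T⊆V∩U {V} T⊆V , closed-restrict {D} {V} cells⊆X closed))))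

S-as-sum : ∀ Y → S Y ≡ sumᴳ (λ D → [ isTiling Y D ]ᴳ s D) (subsets (candidates Y))
S-as-sum Y = sumᴳ-filterᵇ s (isTiling Y) (subsets (candidates Y))

module Decomposition (X : List Point) (uX : Unique X) (T : List Point) (T⊆X : All (_∈ X) T) where

  ClD : List Domino → List Point
  ClD D = filterᵇ (inClD X D T) X

  T⊆ClD : ∀ D → (T ⊆ᵇ ClD D) ≡ true
  T⊆ClD D = all-true⁺ _ T λ t∈T → trans (∈ᵇ-filterᵇ (inClD X D T) _ X)
    (∧-true⁺ (Closure.T⊆inClD X D T T⊆X t∈T) (∈⇒∈ᵇ (All.lookup T⊆X t∈T)))

  closureIs : List Point → List Domino → Bool
  closureIs U D = (U ≡ᵇ ClD D) ∧ isTiling X D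

  isBetween : List Point → Bool
  isBetween U = (T ⊆ᵇ U) ∧ all (inCl X T) U

  module _ (U : List Point) (U∈ : U ∈ subsets X) where
    open BoardSplit X U U∈

    splitsAlong : List Domino → Bool
    splitsAlong D = respects D ∧ (isTiling (X ∖ U) (filterᵇ outer D) ∧
                                  (isTiling U (filterᵇ inner D) ∧ ClDequals U (filterᵇ inner D) T))

    weightOut weightIn : List Domino → ℤ[i]
    weightOut D₁ = [ isTiling (X ∖ U) D₁ ]ᴳ s D₁
    weightIn  D₂ = [ isTiling U D₂ ∧ ClDequals U D₂ T ]ᴳ s D₂

    S-outside : S (X ∖ U) ≡ sumᴳ weightOut (subsets (filterᵇ outer (candidates X)))
    S-outside = trans (S-as-sum (X ∖ U))
                      (cong (sumᴳ weightOut ∘ subsets) (candidates-filterᵇ (λ x → not (x ∈ᵇ U)) X))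

    Srel-inside : Srel T U ≡ sumᴳ weightIn (subsets (filterᵇ inner (candidates X)))
    Srel-inside = begin
      Srel T U
        ≡⟨ cong (sumᴳ s) (filterᵇ-filterᵇ (isTiling U) (λ D → ClDequals U D T) (subsets (candidates U))) ⟩
      sumᴳ s (filterᵇ (λ D → isTiling U D ∧ ClDequals U D T) (subsets (candidates U)))
        ≡⟨ sumᴳ-filterᵇ s (λ D → isTiling U D ∧ ClDequals U D T) (subsets (candidates U)) ⟩
      sumᴳ weightIn (subsets (candidates U))
        ≡⟨ cong (sumᴳ weightIn ∘ subsets ∘ candidates) (sym (filterᵇ-∈ᵇ-subset X uX U∈)) ⟩
      sumᴳ weightIn (subsets (candidates (filterᵇ (_∈ᵇ U) X)))
        ≡⟨ cong (sumᴳ weightIn ∘ subsets) (candidates-filterᵇ (_∈ᵇ U) X) ⟩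
      sumᴳ weightIn (subsets (filterᵇ inner (candidates X))) ∎
      where open ≡-Reasoning

    module _ {D} (D∈ : D ∈ subsets (candidates X)) where

      cells⊆X : CellsIn X D
      cells⊆X = CellsIn-subsets {X} (candidates-CellsIn X) D∈

      splitsAlong⇒closureIs : isBetween U ≡ true → splitsAlong D ≡ true → closureIs U D ≡ true
      splitsAlong⇒closureIs between split =
        ∧-true⁺ (≡⇒≡ᵇ U≡ClD) (trans (isTiling-split {D} resp) (∧-true⁺ tiles-out tiles-in))
        where
        T⊆U : (T ⊆ᵇ U) ≡ true
        T⊆U = proj₁ (∧-true⁻ between)
        resp : respects D ≡ true
        resp = proj₁ (∧-true⁻ split)
        tiles-out : isTiling (X ∖ U) (filterᵇ outer D) ≡ true
        tiles-out = proj₁ (∧-true⁻ (proj₂ (∧-true⁻ {respects D} split)))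
        inner-part : isTiling U (filterᵇ inner D) ≡ true × ClDequals U (filterᵇ inner D) T ≡ true
        inner-part = ∧-true⁻ (proj₂ (∧-true⁻ {isTiling (X ∖ U) (filterᵇ outer D)} (proj₂ (∧-true⁻ {respects D} split))))
        tiles-in = proj₁ inner-part
        closure-in = proj₂ inner-part
        by-side : ∀ {x} b → x ∈ᵇ U ≡ b → inClD X D T x ≡ b
        by-side true  x∈U = trans (inClD-restrict T {D} cells⊆X resp T⊆U x∈U) (all-true⁻ _ U closure-in (∈ᵇ⇒∈ U x∈U))
        by-side false x∉U = inClD-outside T {D} cells⊆X resp T⊆U x∉U
        U≡ClD : U ≡ ClD D
        U≡ClD = trans (sym (filterᵇ-∈ᵇ-subset X uX U∈)) (filterᵇ-cong X λ {x} _ → sym (by-side (x ∈ᵇ U) refl))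

      module _ (closure : closureIs U D ≡ true) where

        U≡ClD : U ≡ ClD D
        U≡ClD = ≡ᵇ-true⁻ (proj₁ (∧-true⁻ closure))

        tiles : isTiling X D ≡ true
        tiles = proj₂ (∧-true⁻ {U ≡ᵇ ClD D} closure)

        T⊆U : (T ⊆ᵇ U) ≡ true
        T⊆U = subst (λ W → (T ⊆ᵇ W) ≡ true) (sym U≡ClD) (T⊆ClD D)

        U⊆ClD : ∀ {u} → u ∈ U → inClD X D T u ≡ true
        U⊆ClD {u} u∈U = proj₂ (∈-filterᵇ⁻ (inClD X D T) X (subst (u ∈_) U≡ClD u∈U))

        closureIs⇒isBetween : isBetween U ≡ true
        closureIs⇒isBetween = ∧-true⁺ T⊆U (all-true⁺ (inCl X T) U λ u∈U →
          any-true⁺ _ (tilings X) (∈-filterᵇ⁺ (isTiling X) _ D∈ tiles) (U⊆ClD u∈U))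

        closureIs⇒splitsAlong : splitsAlong D ≡ true
        closureIs⇒splitsAlong = ∧-true⁺ resp (∧-true⁺ (proj₁ tiles-split) (∧-true⁺ (proj₂ tiles-split) closure-in))
          where
          resp : respects D ≡ true
          resp = trans (respects≡U-closed cells⊆X)
                       (subst (λ W → isClosed X D W ≡ true) (sym U≡ClD) (Closure.inClD-closed X D T cells⊆X))
          tiles-split : isTiling (X ∖ U) (filterᵇ outer D) ≡ true × isTiling U (filterᵇ inner D) ≡ true
          tiles-split = ∧-true⁻ (trans (sym (isTiling-split {D} resp)) tiles)
          closure-in : ClDequals U (filterᵇ inner D) T ≡ true
          closure-in = all-true⁺ _ U λ u∈U →
            trans (sym (inClD-restrict T {D} cells⊆X resp T⊆U (∈⇒∈ᵇ u∈U))) (U⊆ClD u∈U)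

      closureIs-summand : isBetween U ≡ true →
        [ closureIs U D ]ᴳ s D ≡ [ respects D ]ᴳ (weightOut (filterᵇ outer D) *ᴳ weightIn (filterᵇ inner D))
      closureIs-summand between = begin
        [ closureIs U D ]ᴳ s D
          ≡⟨ cong ([_]ᴳ s D) (⇔true⇒≡ closureIs⇒splitsAlong (splitsAlong⇒closureIs between)) ⟩
        [ respects D ∧ (t-out ∧ t-in) ]ᴳ s D
          ≡⟨ sym ([]ᴳ-∧ (respects D) (t-out ∧ t-in) (s D)) ⟩
        [ respects D ]ᴳ [ t-out ∧ t-in ]ᴳ s D
          ≡⟨ []ᴳ-cong (respects D) (λ resp → cong ([ t-out ∧ t-in ]ᴳ_) (s-split {D} resp)) ⟩
        [ respects D ]ᴳ [ t-out ∧ t-in ]ᴳ (s (filterᵇ outer D) *ᴳ s (filterᵇ inner D))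
          ≡⟨ cong ([ respects D ]ᴳ_) (sym ([]ᴳ-*ᴳ t-out t-in (s (filterᵇ outer D)) (s (filterᵇ inner D)))) ⟩
        [ respects D ]ᴳ (weightOut (filterᵇ outer D) *ᴳ weightIn (filterᵇ inner D)) ∎
        where
        open ≡-Reasoning
        t-out = isTiling (X ∖ U) (filterᵇ outer D)
        t-in  = isTiling U (filterᵇ inner D) ∧ ClDequals U (filterᵇ inner D) T

    sumᴳ-closureIs : sumᴳ (λ D → [ closureIs U D ]ᴳ s D) (subsets (candidates X)) ≡
                     [ isBetween U ]ᴳ (S (X ∖ U) *ᴳ Srel T U)
    sumᴳ-closureIs with isBetween U in between
    ... | false = sumᴳ-zero _ (subsets (candidates X)) λ {D} D∈ →
      []ᴳ-false (s D) λ closure → case trans (sym (closureIs⇒isBetween D∈ closure)) between of λ ()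
    ... | true = begin
      sumᴳ (λ D → [ closureIs U D ]ᴳ s D) (subsets Cn)
        ≡⟨ sumᴳ-cong (subsets Cn) (λ D∈ → closureIs-summand D∈ between) ⟩
      sumᴳ (λ D → [ respects D ]ᴳ (weightOut (filterᵇ outer D) *ᴳ weightIn (filterᵇ inner D))) (subsets Cn)
        ≡⟨ sym (sumᴳ-subsets-partition outer inner outer∧inner≡false (λ D₁ D₂ → weightOut D₁ *ᴳ weightIn D₂) Cn) ⟩
      sumᴳ (λ D₁ → sumᴳ (λ D₂ → weightOut D₁ *ᴳ weightIn D₂) (subsets (filterᵇ inner Cn))) (subsets (filterᵇ outer Cn))
        ≡⟨ sumᴳ-*ᴳ-sumᴳ weightOut weightIn (subsets (filterᵇ outer Cn)) (subsets (filterᵇ inner Cn)) ⟩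
      sumᴳ weightOut (subsets (filterᵇ outer Cn)) *ᴳ sumᴳ weightIn (subsets (filterᵇ inner Cn))
        ≡⟨ cong₂ _*ᴳ_ (sym S-outside) (sym Srel-inside) ⟩
      S (X ∖ U) *ᴳ Srel T U ∎
      where
      open ≡-Reasoning
      Cn = candidates X

lemma4p5 : (X : List Point) → Unique X → (T : List Point) → All (_∈ X) T →
    S X ≡ sumᴳ (λ U → S (X ∖ U) *ᴳ Srel T U) (between X T)
lemma4p5 X uX T T⊆X = begin
  S X
    ≡⟨ S-as-sum X ⟩
  sumᴳ (λ D → [ isTiling X D ]ᴳ s D) (subsets Cn)
    ≡⟨ sumᴳ-cong (subsets Cn) (λ {D} _ →
         sym (sumᴳ-subsets-≡ᵇ X uX (filterᵇ-∈-subsets (inClD X D T) X) ([ isTiling X D ]ᴳ s D))) ⟩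
  sumᴳ (λ D → sumᴳ (λ U → [ U ≡ᵇ ClD D ]ᴳ [ isTiling X D ]ᴳ s D) (subsets X)) (subsets Cn)
    ≡⟨ sumᴳ-comm (λ D U → [ U ≡ᵇ ClD D ]ᴳ [ isTiling X D ]ᴳ s D) (subsets Cn) (subsets X) ⟩
  sumᴳ (λ U → sumᴳ (λ D → [ U ≡ᵇ ClD D ]ᴳ [ isTiling X D ]ᴳ s D) (subsets Cn)) (subsets X)
    ≡⟨ sumᴳ-cong (subsets X) (λ {U} U∈ →
         trans (sumᴳ-cong (subsets Cn) (λ {D} _ → []ᴳ-∧ (U ≡ᵇ ClD D) (isTiling X D) (s D)))
               (sumᴳ-closureIs U U∈)) ⟩
  sumᴳ (λ U → [ isBetween U ]ᴳ (S (X ∖ U) *ᴳ Srel T U)) (subsets X)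
    ≡⟨ sym (sumᴳ-filterᵇ (λ U → S (X ∖ U) *ᴳ Srel T U) isBetween (subsets X)) ⟩
  sumᴳ (λ U → S (X ∖ U) *ᴳ Srel T U) (between X T) ∎
  where
  open ≡-Reasoning
  open Decomposition X uX T T⊆X
  Cn = candidates X
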